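{- Let $1\le s\le n$. Two subspaces $U,V \in {\rm Gr}_{s,n}(\mathcal{K})$ are feebly orthogonal if and only if $\mu_n(U) \neq \mu_n(V)$.
   Context: Let $\mathcal{K}$ be a field with a discrete valuation $\nu$, valuation ring $\mathcal{O}$, maximal ideal $\mathfrak{m}$, and finite residue field $\mathcal{O}/\mathfrak{m}\cong\mathbb{F}_q$. Put $|\lambda|=q^{ -\nu(\lambda)}$, $\|\mathbf{v}\|=\max_{i}|v_i|$ on $\mathcal{K}^n$, $\mathbb{B}_n=\{\mathbf v:\|\mathbf v\|=1\}$. Vectors $\mathbf{u},\mathbf{v}$ are orthogonal if $\|a\mathbf{u}+b\mathbf{v}\|=\max(\|a\mathbf{u}\|,\|b\mathbf{v}\|)$ for all $a,b\in\mathcal{K}$; subspaces $U,V$ are orthogonal if all $\mathbf u\in U,\mathbf v\in V$ are orthogonal. $U,V$ are feebly orthogonal if there is $\mathbf{u}\in U\setminus\{\mathbf 0\}$ with $\mathcal{K}\mathbf{u}$ and $V$ orthogonal, or there is $\mathbf{v}\in V\setminus\{\mathbf 0\}$ with $\mathcal{K}\mathbf{v}$ and $U$ orthogonal. ${\rm Gr}_{s,n}(\mathcal{K})$ is the set of $s$-dimensional subspaces of $\mathcal{K}^n$. $\gamma_n:\mathcal{O}^n\to\mathbb{F}_q^n$ is coordinatewise reduction mod $\mathfrak{m}$, and for a nonzero subspace $V$, $\mu_n(V)=\gamma_n(V\cap\mathbb{B}_n)\cup\{\mathbf 0\}\subseteq\mathbb{F}_q^n$. -}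

module Defs where

open import Data.Nat using (ℕ; zero; suc)
open import Data.Integer using (ℤ; +_; _⊓_) renaming (_+_ to _+ℤ_; _≤_ to _≤ℤ_)
open import Data.Fin using (Fin)
import Data.Fin as Fin
open import Data.Product using (Σ; ∃; _×_; _,_)
open import Data.Sum using (_⊎_)
open import Relation.Binary.PropositionalEquality using (_≡_; _≢_)
open import Relation.Nullary using (¬_)
open import Function.Bundles using (_↔_)
open import Algebra.Structures using (IsCommutativeRing)

data ℤ∞ : Set where
  fin : ℤ → ℤ∞
  ∞   : ℤ∞

_⊓∞_ : ℤ∞ → ℤ∞ → ℤ∞
fin a ⊓∞ fin b = fin (a ⊓ b)
fin a ⊓∞ ∞     = fin a
∞     ⊓∞ y     = y

_+∞_ : ℤ∞ → ℤ∞ → ℤ∞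
fin a +∞ fin b = fin (a +ℤ b)
fin a +∞ ∞     = ∞
∞     +∞ y     = ∞

data _≤∞_ : ℤ∞ → ℤ∞ → Set where
  fin≤fin : ∀ {a b} → a ≤ℤ b → fin a ≤∞ fin b
  _≤∞∞    : ∀ x → x ≤∞ ∞

-- A field K with a (normalised) discrete valuation ν : K → ℤ ∪ {∞},
-- valuation ring O = {ν ≥ 0}, maximal ideal m = {ν ≥ 1}, together with
-- a finite ring F and a reduction map red : K → F whose restriction
-- to O is a surjective ring homomorphism with kernel m (so O/m ≅ F,
-- a finite field 𝔽_q).  Values of red outside O are irrelevant.

record DVField : Set₁ where
  field
    K     : Set
    _+_   : K → K → K
    _*_   : K → K → K
    -_    : K → K
    0#    : K
    1#    : K
    isCommutativeRing : IsCommutativeRing _≡_ _+_ _*_ -_ 0# 1#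
    0≢1   : 0# ≢ 1#
    inverse : ∀ x → x ≢ 0# → ∃ λ y → x * y ≡ 1#

    ν      : K → ℤ∞
    ν-∞    : ∀ x → (ν x ≡ ∞ → x ≡ 0#) × (x ≡ 0# → ν x ≡ ∞)
    ν-*    : ∀ x y → ν (x * y) ≡ ν x +∞ ν y
    ν-+    : ∀ x y → (ν x ⊓∞ ν y) ≤∞ ν (x + y)
    uniformizer : ∃ λ π → ν π ≡ fin (+ 1)

    F      : Set
    _+F_   : F → F → F
    _*F_   : F → F → F
    -F_    : F → F
    0F     : F
    1F     : F
    isCommutativeRingF : IsCommutativeRing _≡_ _+F_ _*F_ -F_ 0F 1F
    q      : ℕ
    F-finite : F ↔ Fin q
    red    : K → F
    red-+  : ∀ x y → fin (+ 0) ≤∞ ν x → fin (+ 0) ≤∞ ν y → red (x + y) ≡ red x +F red y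
    red-*  : ∀ x y → fin (+ 0) ≤∞ ν x → fin (+ 0) ≤∞ ν y → red (x * y) ≡ red x *F red y
    red-1  : red 1# ≡ 1F
    red-surj : ∀ f → ∃ λ x → fin (+ 0) ≤∞ ν x × red x ≡ f
    red-ker  : ∀ x → fin (+ 0) ≤∞ ν x → (red x ≡ 0F → fin (+ 1) ≤∞ ν x) × (fin (+ 1) ≤∞ ν x → red x ≡ 0F)

module Theory (D : DVField) where
  open DVField D

  Vecᴷ : ℕ → Set
  Vecᴷ n = Fin n → K

  _≋_ : ∀ {A : Set} {n} → (Fin n → A) → (Fin n → A) → Set
  u ≋ v = ∀ i → u i ≡ v i

  0ᵛ : ∀ {n} → Vecᴷ n
  0ᵛ _ = 0#

  _+ᵛ_ : ∀ {n} → Vecᴷ n → Vecᴷ n → Vecᴷ n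
  (u +ᵛ v) i = u i + v i

  _·_ : ∀ {n} → K → Vecᴷ n → Vecᴷ n
  (a · v) i = a * v i

  lincomb : ∀ {s n} → (Fin s → K) → (Fin s → Vecᴷ n) → Vecᴷ n
  lincomb {zero}  c b = 0ᵛ
  lincomb {suc s} c b = (c Fin.zero · b Fin.zero) +ᵛ lincomb (λ j → c (Fin.suc j)) (λ j → b (Fin.suc j))

  LinIndep : ∀ {s n} → (Fin s → Vecᴷ n) → Set
  LinIndep b = ∀ c → lincomb c b ≋ 0ᵛ → ∀ j → c j ≡ 0#

  Span : ∀ {s n} → (Fin s → Vecᴷ n) → Vecᴷ n → Set
  Span b v = ∃ λ c → v ≋ lincomb c b

  -- The s-dimensional subspace V ∈ Gr_{s,n}(K) is represented by a
  -- basis b (s linearly independent vectors) and V = Span b.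

  Line : ∀ {n} → Vecᴷ n → Vecᴷ n → Set
  Line u w = ∃ λ a → w ≋ (a · u)

  -- valuation of a vector: min_i ν(v_i); so ‖v‖ = q^{-νᵛ v}
  νᵛ : ∀ {n} → Vecᴷ n → ℤ∞
  νᵛ {zero}  v = ∞
  νᵛ {suc n} v = ν (v Fin.zero) ⊓∞ νᵛ (λ i → v (Fin.suc i))

  -- ‖a u + b v‖ = max(‖a u‖, ‖b v‖), written via valuations
  -- (x ↦ q^{-x} is an order-reversing bijection, so max ↔ min)
  Orthogonal : ∀ {n} → Vecᴷ n → Vecᴷ n → Set
  Orthogonal u v = ∀ a b → νᵛ ((a · u) +ᵛ (b · v)) ≡ (νᵛ (a · u) ⊓∞ νᵛ (b · v))

  OrthogonalSub : ∀ {n} → (Vecᴷ n → Set) → (Vecᴷ n → Set) → Set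
  OrthogonalSub U V = ∀ u v → U u → V v → Orthogonal u v

  FeeblyOrthogonal : ∀ {n} → (Vecᴷ n → Set) → (Vecᴷ n → Set) → Set
  FeeblyOrthogonal U V =
      (∃ λ u → U u × ¬ (u ≋ 0ᵛ) × OrthogonalSub (Line u) V)
    ⊎ (∃ λ v → V v × ¬ (v ≋ 0ᵛ) × OrthogonalSub (Line v) U)

  InSphere : ∀ {n} → Vecᴷ n → Set
  InSphere v = νᵛ v ≡ fin (+ 0)

  γ : ∀ {n} → Vecᴷ n → (Fin n → F)
  γ v i = red (v i)

  μ : ∀ {n} → (Vecᴷ n → Set) → (Fin n → F) → Set
  μ V x = (∃ λ v → V v × InSphere v × γ v ≋ x) ⊎ (x ≋ (λ _ → 0F))

  SameSet : ∀ {n} → ((Fin n → F) → Set) → ((Fin n → F) → Set) → Set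
  SameSet A B = ∀ x → (A x → B x) × (B x → A x)

module Submission where

-- A unit vector u is orthogonal to a subspace V exactly when its residue γ u lies outside μ V.
-- If γ u = γ v for a unit vector v ∈ V, then ‖u − v‖ < 1 = max (‖u‖, ‖v‖).  Conversely, if
-- γ u ∉ μ V, then for y ∈ V the sum u + y can only lose norm when ‖y‖ = ‖u‖ = 1, and there
-- γ (u + y) = 0 would make γ u the residue of the unit vector −y ∈ V; scaling reduces a u + b v
-- to this case.  Hence feeble orthogonality of U and V forces μ U ≠ μ V.
--
-- Bring a spanning family of each subspace
-- into echelon form over the valuation ring: unit vectors, each equal to 1 at its pivot and
-- vanishing at the pivots of the later ones.  An integral vector of the span then has integral
-- coefficients, so μ V is the 𝔽_q-span of the residues of the echelon vectors.  This makes
-- membership in μ V decidable, and if μ U ≠ μ V, some echelon vector of one subspace has its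
-- residue outside μ of the other subspace, hence is a unit vector orthogonal to it.

open import Defs
open import Level using (0ℓ)
open import Algebra.Bundles using (AbelianGroup; CommutativeRing)
open import Algebra.Construct.NaturalChoice.Base using (MinOperator)
import Algebra.Construct.NaturalChoice.MinOp as MinOp
import Algebra.Properties.Group as GroupProperties
open import Data.Empty using (⊥-elim)
open import Data.Fin using (Fin; zero; suc)
import Data.Fin.Properties as Fin
open import Data.Integer as ℤ using (+_; -[1+_]; +≤+; -≤+)
import Data.Integer.Properties as ℤ
open import Data.List using (List; []; _∷_; map; tabulate)
open import Data.List.Membership.Propositional using (_∈_; find)
open import Data.List.Relation.Unary.All as All using (All; []; _∷_)
open import Data.List.Relation.Unary.All.Properties using (¬All⇒Any¬; map⁺)
open import Data.List.Relation.Unary.Any using (here; there)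
open import Data.Nat using (ℕ; zero; suc; _≤_; s≤s; z≤n)
open import Data.Product using (∃; ∃₂; _×_; _,_; proj₁; proj₂)
open import Data.Sum as Sum using (_⊎_; inj₁; inj₂)
import Data.Vec.Functional as Vector
open import Function using (_∘_; id)
open import Function.Bundles using (Inverse; _⇔_; mk⇔)
open import Function.Properties.Inverse using (↔⇒↣)
open import Relation.Binary.Bundles using (TotalPreorder)
open import Relation.Binary.Definitions using (DecidableEquality)
import Relation.Binary.Definitions as B
open import Relation.Binary.PropositionalEquality
open import Relation.Nullary using (¬_; Dec; yes; no)
import Relation.Nullary.Decidable as Dec
open import Relation.Unary using (Decidable; _⊆_; _≐_)
open import Relation.Unary.Properties using (≐-trans)

fin≢∞ : ∀ {a} → fin a ≢ ∞
fin≢∞ ()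

1≰0 : ¬ (fin (+ 1) ≤∞ fin (+ 0))
1≰0 (fin≤fin (+≤+ ()))

≤∞-reflexive : ∀ {x y} → x ≡ y → x ≤∞ y
≤∞-reflexive {fin a} refl = fin≤fin ℤ.≤-refl
≤∞-reflexive {∞}     refl = ∞ ≤∞∞

≤∞-trans : ∀ {x y z} → x ≤∞ y → y ≤∞ z → x ≤∞ z
≤∞-trans (fin≤fin p) (fin≤fin q) = fin≤fin (ℤ.≤-trans p q)
≤∞-trans _           (_ ≤∞∞)     = _ ≤∞∞

≤∞-antisym : ∀ {x y} → x ≤∞ y → y ≤∞ x → x ≡ y
≤∞-antisym (fin≤fin p) (fin≤fin q) = cong fin (ℤ.≤-antisym p q)
≤∞-antisym (_ ≤∞∞)     (_ ≤∞∞)     = refl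

≤∞-total : ∀ x y → x ≤∞ y ⊎ y ≤∞ x
≤∞-total (fin a) (fin b) = Sum.map fin≤fin fin≤fin (ℤ.≤-total a b)
≤∞-total x       ∞       = inj₁ (x ≤∞∞)
≤∞-total ∞       (fin b) = inj₂ (fin b ≤∞∞)

_≤∞?_ : ∀ x y → Dec (x ≤∞ y)
fin a ≤∞? fin b = Dec.map′ fin≤fin (λ { (fin≤fin a≤b) → a≤b }) (a ℤ.≤? b)
x     ≤∞? ∞     = yes (x ≤∞∞)
∞     ≤∞? fin b = no λ ()

≰1⇒≤0 : ∀ {x} → ¬ (fin (+ 1) ≤∞ x) → x ≤∞ fin (+ 0)
≰1⇒≤0 {fin (+ zero)}  _   = ≤∞-reflexive refl
≰1⇒≤0 {fin (+ suc k)} 1≰x = ⊥-elim (1≰x (fin≤fin (+≤+ (s≤s z≤n))))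
≰1⇒≤0 {fin -[1+ k ]}  _   = fin≤fin -≤+
≰1⇒≤0 {∞}             1≰x = ⊥-elim (1≰x (_ ≤∞∞))

≤∞-totalPreorder : TotalPreorder 0ℓ 0ℓ 0ℓ
≤∞-totalPreorder = record
  { isTotalPreorder = record
    { isPreorder = record
      { isEquivalence = isEquivalence
      ; reflexive     = ≤∞-reflexive
      ; trans         = ≤∞-trans
      }
    ; total = ≤∞-total
    }
  }

x≤y⇒x⊓∞y≡x : ∀ {x y} → x ≤∞ y → x ⊓∞ y ≡ x
x≤y⇒x⊓∞y≡x (fin≤fin a≤b) = cong fin (ℤ.i≤j⇒i⊓j≡i a≤b)
x≤y⇒x⊓∞y≡x (fin a ≤∞∞)   = refl
x≤y⇒x⊓∞y≡x (∞ ≤∞∞)       = refl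

y≤x⇒x⊓∞y≡y : ∀ {x y} → y ≤∞ x → x ⊓∞ y ≡ y
y≤x⇒x⊓∞y≡y (fin≤fin b≤a) = cong fin (ℤ.i≥j⇒i⊓j≡j b≤a)
y≤x⇒x⊓∞y≡y (_ ≤∞∞)       = refl

⊓∞-minOperator : MinOperator ≤∞-totalPreorder
⊓∞-minOperator = record
  { _⊓_       = _⊓∞_
  ; x≤y⇒x⊓y≈x = x≤y⇒x⊓∞y≡x
  ; x≥y⇒x⊓y≈y = y≤x⇒x⊓∞y≡y
  }

open MinOp ⊓∞-minOperator
  using () renaming (x⊓y≤x to x⊓∞y≤x; x⊓y≤y to x⊓∞y≤y; ⊓-sel to ⊓∞-sel; ⊓-comm to ⊓∞-comm;
                     ⊓-glb to ⊓∞-glb; ⊓-mono-≤ to ⊓∞-mono-≤)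

+∞-identityˡ : ∀ x → fin (+ 0) +∞ x ≡ x
+∞-identityˡ (fin a) = cong fin (ℤ.+-identityˡ a)
+∞-identityˡ ∞       = refl

+∞-zeroʳ : ∀ x → x +∞ ∞ ≡ ∞
+∞-zeroʳ (fin a) = refl
+∞-zeroʳ ∞       = refl

+∞-distribˡ-⊓∞ : ∀ x y z → x +∞ (y ⊓∞ z) ≡ (x +∞ y) ⊓∞ (x +∞ z)
+∞-distribˡ-⊓∞ (fin a) (fin b) (fin c) = cong fin (ℤ.mono-≤-distrib-⊓ (ℤ.+-monoʳ-≤ a) b c)
+∞-distribˡ-⊓∞ (fin a) (fin b) ∞       = refl
+∞-distribˡ-⊓∞ (fin a) ∞       z       = refl
+∞-distribˡ-⊓∞ ∞       y       z       = refl

+∞-pres-0≤ : ∀ {x y} → fin (+ 0) ≤∞ x → fin (+ 0) ≤∞ y → fin (+ 0) ≤∞ (x +∞ y)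
+∞-pres-0≤ (fin≤fin 0≤a) (fin≤fin 0≤b) = fin≤fin (ℤ.+-mono-≤ 0≤a 0≤b)
+∞-pres-0≤ (fin≤fin _)   (_ ≤∞∞)       = _ ≤∞∞
+∞-pres-0≤ (_ ≤∞∞)       _             = _ ≤∞∞

x+∞x≡x⇒x≡0 : ∀ {x} → x +∞ x ≡ x → x ≢ ∞ → x ≡ fin (+ 0)
x+∞x≡x⇒x≡0 {fin a} a+a≡a _ = cong fin (identityˡ-unique a a (fin-injective a+a≡a))
  where
  open GroupProperties (AbelianGroup.group ℤ.+-0-abelianGroup) using (identityˡ-unique)
  fin-injective : ∀ {a b} → fin a ≡ fin b → a ≡ b
  fin-injective refl = refl
x+∞x≡x⇒x≡0 {∞} _ x≢∞ = ⊥-elim (x≢∞ refl)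

x+∞x≡0⇒x≡0 : ∀ {x} → x +∞ x ≡ fin (+ 0) → x ≡ fin (+ 0)
x+∞x≡0⇒x≡0 {fin (+ zero)} _ = refl
x+∞x≡0⇒x≡0 {fin (+ suc k)} ()
x+∞x≡0⇒x≡0 {fin -[1+ k ]} ()


module LinearSpan (R : CommutativeRing 0ℓ 0ℓ) where

  open CommutativeRing R renaming (refl to ≈-refl; sym to ≈-sym; trans to ≈-trans)
  open import Algebra.Properties.Ring ring using (-1*x≈-x)
  open import Algebra.Properties.AbelianGroup +-abelianGroup using (xyx⁻¹≈y)
  open import Algebra.Properties.CommutativeSemigroup +-commutativeSemigroup using (interchange)
  open GroupProperties +-group using (x≈z//y)

  infix  4 _≋_
  infixl 6 _+ᵛ_ _-ᵛ_
  infixr 7 _·_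
  infix  8 -ᵛ_

  _≋_ : ∀ {n} → (Fin n → Carrier) → (Fin n → Carrier) → Set
  u ≋ v = ∀ i → u i ≈ v i

  0ᵛ : ∀ {n} → Fin n → Carrier
  0ᵛ _ = 0#

  _+ᵛ_ : ∀ {n} → (Fin n → Carrier) → (Fin n → Carrier) → Fin n → Carrier
  (u +ᵛ v) i = u i + v i

  -ᵛ_ : ∀ {n} → (Fin n → Carrier) → Fin n → Carrier
  (-ᵛ v) i = - v i

  _-ᵛ_ : ∀ {n} → (Fin n → Carrier) → (Fin n → Carrier) → Fin n → Carrier
  u -ᵛ v = u +ᵛ -ᵛ v

  _·_ : ∀ {n} → Carrier → (Fin n → Carrier) → Fin n → Carrier
  (c · v) i = c * v i

  module _ {n : ℕ} where

    Span : List (Fin n → Carrier) → (Fin n → Carrier) → Set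
    Span []       w = w ≋ 0ᵛ
    Span (u ∷ us) w = ∃₂ λ c w′ → Span us w′ × w ≋ c · u +ᵛ w′

    Span-resp : ∀ us {v w} → v ≋ w → Span us v → Span us w
    Span-resp []       v≋w v≋0                 i = ≈-trans (≈-sym (v≋w i)) (v≋0 i)
    Span-resp (u ∷ us) v≋w (c , v′ , v′∈ , v≋) = c , v′ , v′∈ , λ i → ≈-trans (≈-sym (v≋w i)) (v≋ i)

    Span-0 : ∀ us → Span us 0ᵛ
    Span-0 []       i = ≈-refl
    Span-0 (u ∷ us)   = 0# , 0ᵛ , Span-0 us , λ i → ≈-sym (≈-trans (+-identityʳ _) (zeroˡ (u i)))

    Span-+ : ∀ us {v w} → Span us v → Span us w → Span us (v +ᵛ w)
    Span-+ []       v≋0 w≋0 i = ≈-trans (+-cong (v≋0 i) (w≋0 i)) (+-identityˡ 0#)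
    Span-+ (u ∷ us) (c , v′ , v′∈ , v≋) (d , w′ , w′∈ , w≋) =
      c + d , v′ +ᵛ w′ , Span-+ us v′∈ w′∈ , λ i →
        ≈-trans (+-cong (v≋ i) (w≋ i))
                (≈-trans (interchange _ _ _ _) (+-cong (≈-sym (distribʳ (u i) c d)) ≈-refl))

    Span-· : ∀ us k {w} → Span us w → Span us (k · w)
    Span-· []       k w≋0                 i = ≈-trans (*-congˡ (w≋0 i)) (zeroʳ k)
    Span-· (u ∷ us) k (c , w′ , w′∈ , w≋) = k * c , k · w′ , Span-· us k w′∈ , λ i →
      ≈-trans (*-congˡ (w≋ i)) (≈-trans (distribˡ k _ _) (+-cong (≈-sym (*-assoc k c (u i))) ≈-refl))

    Span-- : ∀ us {v w} → Span us v → Span us w → Span us (v -ᵛ w)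
    Span-- us {w = w} v∈ w∈ =
      Span-resp us (λ i → +-cong ≈-refl (-1*x≈-x (w i))) (Span-+ us v∈ (Span-· us (- 1#) w∈))

    Span-head : ∀ {u us} → Span (u ∷ us) u
    Span-head {u} {us} = 1# , 0ᵛ , Span-0 us , λ i → ≈-sym (≈-trans (+-identityʳ _) (*-identityˡ (u i)))

    Span-⊆-∷ : ∀ {u us} → Span us ⊆ Span (u ∷ us)
    Span-⊆-∷ {u} {x = w} w∈ =
      0# , w , w∈ , λ i → ≈-sym (≈-trans (+-cong (zeroˡ (u i)) ≈-refl) (+-identityˡ (w i)))

    Span-∷-⊆ : ∀ {u us vs} → Span vs u → Span us ⊆ Span vs → Span (u ∷ us) ⊆ Span vs
    Span-∷-⊆ {vs = vs} u∈ us⊆vs (c , w′ , w′∈ , w≋) =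
      Span-resp vs (λ i → ≈-sym (w≋ i)) (Span-+ vs (Span-· vs c u∈) (us⊆vs w′∈))

    Span-⊆ : ∀ {us vs} → All (Span vs) us → Span us ⊆ Span vs
    Span-⊆ {vs = vs} []         w≋0 = Span-resp vs (λ i → ≈-sym (w≋0 i)) (Span-0 vs)
    Span-⊆           (u∈ ∷ us∈)     = Span-∷-⊆ u∈ (Span-⊆ us∈)

    ∈⇒∈Span : ∀ {u us} → u ∈ us → Span us u
    ∈⇒∈Span (here refl)  = Span-head
    ∈⇒∈Span (there u∈us) = Span-⊆-∷ (∈⇒∈Span u∈us)

    Span-∷-cong : ∀ {u us vs} → Span us ≐ Span vs → Span (u ∷ us) ≐ Span (u ∷ vs)
    Span-∷-cong (us⊆vs , vs⊆us) =
      Span-∷-⊆ Span-head (λ w∈ → Span-⊆-∷ (us⊆vs w∈)) , Span-∷-⊆ Span-head (λ w∈ → Span-⊆-∷ (vs⊆us w∈))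

    Span-∷-shear : ∀ {u u′ v us} → Span us v → u′ ≋ u +ᵛ v → Span (u ∷ us) ≐ Span (u′ ∷ us)
    Span-∷-shear {u} {u′} {v} {us} v∈ u′≋ =
        Span-∷-⊆ (Span-resp _ u′-v≋u (Span-- _ Span-head (Span-⊆-∷ v∈))) Span-⊆-∷
      , Span-∷-⊆ (Span-resp _ (λ i → ≈-sym (u′≋ i)) (Span-+ _ Span-head (Span-⊆-∷ v∈))) Span-⊆-∷
      where
      u′-v≋u : u′ -ᵛ v ≋ u
      u′-v≋u i = ≈-sym (x≈z//y (u i) (v i) (u′ i) (≈-sym (u′≋ i)))

    Span-∷-scale : ∀ {δ′ δ u us} → δ′ * δ ≈ 1# → Span (u ∷ us) ≐ Span (δ · u ∷ us)
    Span-∷-scale {δ′} {δ} {u} δ′δ≈1 =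
        Span-∷-⊆ (Span-resp _ δ′δu≋u (Span-· _ δ′ Span-head)) Span-⊆-∷
      , Span-∷-⊆ (Span-· _ δ Span-head) Span-⊆-∷
      where
      δ′δu≋u : δ′ · δ · u ≋ u
      δ′δu≋u i = ≈-trans (≈-sym (*-assoc δ′ δ (u i))) (≈-trans (*-congʳ δ′δ≈1) (*-identityˡ (u i)))

    Span-∷-0 : ∀ {u us} → u ≋ 0ᵛ → Span (u ∷ us) ≐ Span us
    Span-∷-0 {us = us} u≋0 = Span-∷-⊆ (Span-resp us (λ i → ≈-sym (u≋0 i)) (Span-0 us)) id , Span-⊆-∷

    Span-∷⇔ : ∀ {u us w} → (∃ λ c → Span us (w -ᵛ c · u)) ⇔ Span (u ∷ us) w
    Span-∷⇔ {u} {us} {w} = mk⇔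
      (λ (c , w-cu∈) → c , w -ᵛ c · u , w-cu∈ , λ i →
        ≈-sym (≈-trans (≈-sym (+-assoc _ _ _)) (xyx⁻¹≈y (c * u i) (w i))))
      (λ (c , w′ , w′∈ , w≋) → c , Span-resp us (λ i →
        ≈-sym (≈-trans (+-cong (w≋ i) ≈-refl) (xyx⁻¹≈y (c * u i) (w′ i)))) w′∈)

    Span? : B.Decidable _≈_ → (∀ {P : Carrier → Set} → Decidable P → Dec (∃ P)) →
            ∀ us → Decidable (Span us)
    Span? _≟_ ∃? []       w = Fin.all? (λ i → w i ≟ 0#)
    Span? _≟_ ∃? (u ∷ us) w = Dec.map Span-∷⇔ (∃? (λ c → Span? _≟_ ∃? us (w -ᵛ c · u)))

module ValuedField (D : DVField) where

  open DVField D hiding (_+_; _*_; -_; 0#; 1#)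
  open Theory D
    using (Vecᴷ; νᵛ; InSphere; γ; μ; Span; lincomb; Line; OrthogonalSub; FeeblyOrthogonal; SameSet)

  K-ring : CommutativeRing 0ℓ 0ℓ
  K-ring = record { isCommutativeRing = isCommutativeRing }

  F-ring : CommutativeRing 0ℓ 0ℓ
  F-ring = record { isCommutativeRing = isCommutativeRingF }

  open CommutativeRing K-ring
    using (_+_; _*_; -_; 0#; 1#; ring; +-group; +-commutativeSemigroup; +-comm; +-identityˡ; +-identityʳ;
           -‿inverseˡ; -‿inverseʳ; *-comm; *-assoc; *-identityˡ; *-identityʳ; zeroˡ; zeroʳ; distribˡ)
  open import Algebra.Properties.CommutativeSemigroup +-commutativeSemigroup using (x∙yz≈y∙xz)
  open import Algebra.Properties.Ring ring using (-1*x≈-x)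
  private
    module KG = GroupProperties +-group
    module FG = GroupProperties (CommutativeRing.+-group F-ring)
  module 𝕂 = LinearSpan K-ring
  module 𝔽 = LinearSpan F-ring
  open 𝕂 using (_≋_; 0ᵛ; _+ᵛ_; -ᵛ_; _·_)
  open ≡-Reasoning

  Integral : K → Set
  Integral x = fin (+ 0) ≤∞ ν x

  Integralᵛ : ∀ {m} → Vecᴷ m → Set
  Integralᵛ v = ∀ i → Integral (v i)

  ν-0 : ν 0# ≡ ∞
  ν-0 = proj₂ (ν-∞ 0#) refl

  ν≡∞⇒≡0 : ∀ {x} → ν x ≡ ∞ → x ≡ 0#
  ν≡∞⇒≡0 = proj₁ (ν-∞ _)

  _≟0 : ∀ x → Dec (x ≡ 0#)
  x ≟0 with ν x in νx≡
  ... | ∞     = yes (ν≡∞⇒≡0 νx≡)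
  ... | fin _ = no λ x≡0 → fin≢∞ (trans (sym νx≡) (trans (cong ν x≡0) ν-0))

  ν-1 : ν 1# ≡ fin (+ 0)
  ν-1 = x+∞x≡x⇒x≡0 (trans (sym (ν-* 1# 1#)) (cong ν (*-identityˡ 1#)))
                   (λ ν1≡∞ → 0≢1 (sym (ν≡∞⇒≡0 ν1≡∞)))

  ν-inverse : ∀ {x y} → x * y ≡ 1# → ν x +∞ ν y ≡ fin (+ 0)
  ν-inverse {x} {y} xy≡1 = trans (sym (ν-* x y)) (trans (cong ν xy≡1) ν-1)

  ν-‿1 : ν (- 1#) ≡ fin (+ 0)
  ν-‿1 = x+∞x≡0⇒x≡0 (ν-inverse (trans (-1*x≈-x (- 1#)) (KG.⁻¹-involutive 1#)))

  ν-‿ : ∀ x → ν (- x) ≡ ν x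
  ν-‿ x = begin
    ν (- x)           ≡⟨ cong ν (sym (-1*x≈-x x)) ⟩
    ν (- 1# * x)      ≡⟨ ν-* (- 1#) x ⟩
    ν (- 1#) +∞ ν x   ≡⟨ cong (_+∞ ν x) ν-‿1 ⟩
    fin (+ 0) +∞ ν x  ≡⟨ +∞-identityˡ (ν x) ⟩
    ν x               ∎

  Integral-0 : Integral 0#
  Integral-0 = subst (fin (+ 0) ≤∞_) (sym ν-0) (_ ≤∞∞)

  Integral-+ : ∀ {x y} → Integral x → Integral y → Integral (x + y)
  Integral-+ {x} {y} ix iy = ≤∞-trans (⊓∞-glb ix iy) (ν-+ x y)

  Integral-* : ∀ {x y} → Integral x → Integral y → Integral (x * y)
  Integral-* {x} {y} ix iy = subst (fin (+ 0) ≤∞_) (sym (ν-* x y)) (+∞-pres-0≤ ix iy)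

  Integral-‿ : ∀ {x} → Integral x → Integral (- x)
  Integral-‿ {x} = subst (fin (+ 0) ≤∞_) (sym (ν-‿ x))

  red-0 : red 0# ≡ 0F
  red-0 = proj₂ (red-ker 0# Integral-0) (subst (fin (+ 1) ≤∞_) (sym ν-0) (_ ≤∞∞))

  red-‿ : ∀ {x} → Integral x → red (- x) ≡ -F red x
  red-‿ {x} ix = FG.inverseʳ-unique (red x) (red (- x)) (begin
    red x +F red (- x)  ≡⟨ sym (red-+ x (- x) ix (Integral-‿ ix)) ⟩
    red (x + - x)       ≡⟨ cong red (-‿inverseʳ x) ⟩
    red 0#              ≡⟨ red-0 ⟩
    0F                  ∎)

  unit⇒red≢0 : ∀ {x} → ν x ≡ fin (+ 0) → red x ≢ 0F
  unit⇒red≢0 {x} νx≡0 redx≡0 =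
    1≰0 (subst (fin (+ 1) ≤∞_) νx≡0 (proj₁ (red-ker x (≤∞-reflexive (sym νx≡0))) redx≡0))

  red≢0⇒unit : ∀ {x} → Integral x → red x ≢ 0F → ν x ≡ fin (+ 0)
  red≢0⇒unit {x} ix redx≢0 = ≤∞-antisym (≰1⇒≤0 (redx≢0 ∘ proj₂ (red-ker x ix))) ix

  red≡⇒1≤ν[x-y] : ∀ {x y} → Integral x → Integral y → red x ≡ red y → fin (+ 1) ≤∞ ν (x + - y)
  red≡⇒1≤ν[x-y] {x} {y} ix iy redx≡redy =
    proj₁ (red-ker (x + - y) (Integral-+ ix (Integral-‿ iy))) (begin
      red (x + - y)        ≡⟨ red-+ x (- y) ix (Integral-‿ iy) ⟩
      red x +F red (- y)   ≡⟨ cong (red x +F_) (red-‿ iy) ⟩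
      red x +F (-F red y)  ≡⟨ FG.x≈y⇒x∙y⁻¹≈ε redx≡redy ⟩
      0F                   ∎)

  _≟F_ : DecidableEquality F
  _≟F_ = Dec.via-injection (↔⇒↣ F-finite) Fin._≟_

  ∃F? : ∀ {P : F → Set} → Decidable P → Dec (∃ P)
  ∃F? {P} P? = Dec.map′ (λ (i , p) → from i , p)
                        (λ (a , p) → to a , subst P (sym (strictlyInverseʳ a)) p)
                        (Fin.any? (P? ∘ from))
    where open Inverse F-finite

  νᵛ-cong : ∀ {m} {u v : Vecᴷ m} → (∀ i → ν (u i) ≡ ν (v i)) → νᵛ u ≡ νᵛ v
  νᵛ-cong {zero}  _   = refl
  νᵛ-cong {suc m} ν≡ = cong₂ _⊓∞_ (ν≡ zero) (νᵛ-cong (ν≡ ∘ suc))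

  νᵛ-resp : ∀ {m} {u v : Vecᴷ m} → u ≋ v → νᵛ u ≡ νᵛ v
  νᵛ-resp u≋v = νᵛ-cong (cong ν ∘ u≋v)

  νᵛ≤ν : ∀ {m} (v : Vecᴷ m) i → νᵛ v ≤∞ ν (v i)
  νᵛ≤ν v zero    = x⊓∞y≤x _ _
  νᵛ≤ν v (suc i) = ≤∞-trans (x⊓∞y≤y _ _) (νᵛ≤ν (v ∘ suc) i)

  νᵛ-glb : ∀ {m z} (v : Vecᴷ m) → (∀ i → z ≤∞ ν (v i)) → z ≤∞ νᵛ v
  νᵛ-glb {zero}  v _   = _ ≤∞∞
  νᵛ-glb {suc m} v z≤ = ⊓∞-glb (z≤ zero) (νᵛ-glb (v ∘ suc) (z≤ ∘ suc))

  νᵛ-attained : ∀ {m} (v : Vecᴷ m) → νᵛ v ≡ ∞ ⊎ ∃ λ i → νᵛ v ≡ ν (v i)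
  νᵛ-attained {zero}  v = inj₁ refl
  νᵛ-attained {suc m} v with ⊓∞-sel (ν (v zero)) (νᵛ (v ∘ suc)) | νᵛ-attained (v ∘ suc)
  ... | inj₁ min≡head | _                = inj₂ (zero , min≡head)
  ... | inj₂ min≡tail | inj₁ tail≡∞      = inj₁ (trans min≡tail tail≡∞)
  ... | inj₂ min≡tail | inj₂ (i , tail≡) = inj₂ (suc i , trans min≡tail tail≡)

  νᵛ≡∞⇒≋0 : ∀ {m} {v : Vecᴷ m} → νᵛ v ≡ ∞ → v ≋ 0ᵛ
  νᵛ≡∞⇒≋0 {v = v} νᵛv≡∞ i =
    ν≡∞⇒≡0 (≤∞-antisym (_ ≤∞∞) (subst (_≤∞ ν (v i)) νᵛv≡∞ (νᵛ≤ν v i)))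

  νᵛ-· : ∀ {m} c (v : Vecᴷ m) → νᵛ (c · v) ≡ ν c +∞ νᵛ v
  νᵛ-· {zero}  c v = sym (+∞-zeroʳ (ν c))
  νᵛ-· {suc m} c v = begin
    ν (c * v zero) ⊓∞ νᵛ (c · (v ∘ suc))          ≡⟨ cong₂ _⊓∞_ (ν-* c (v zero)) (νᵛ-· c (v ∘ suc)) ⟩
    (ν c +∞ ν (v zero)) ⊓∞ (ν c +∞ νᵛ (v ∘ suc))  ≡⟨ sym (+∞-distribˡ-⊓∞ (ν c) _ _) ⟩
    ν c +∞ νᵛ v                                   ∎

  νᵛ-‿ : ∀ {m} (v : Vecᴷ m) → νᵛ (-ᵛ v) ≡ νᵛ v
  νᵛ-‿ v = νᵛ-cong (ν-‿ ∘ v)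

  νᵛ-+ : ∀ {m} (u v : Vecᴷ m) → (νᵛ u ⊓∞ νᵛ v) ≤∞ νᵛ (u +ᵛ v)
  νᵛ-+ u v = νᵛ-glb (u +ᵛ v) λ i → ≤∞-trans (⊓∞-mono-≤ (νᵛ≤ν u i) (νᵛ≤ν v i)) (ν-+ (u i) (v i))

  νᵛ-+-dominant : ∀ {m} (u v : Vecᴷ m) → ¬ (νᵛ v ≤∞ νᵛ u) → νᵛ (u +ᵛ v) ≡ νᵛ u ⊓∞ νᵛ v
  νᵛ-+-dominant u v v≰u = ≤∞-antisym upper (νᵛ-+ u v)
    where
    u≤v : νᵛ u ≤∞ νᵛ v
    u≤v = Sum.[ id , ⊥-elim ∘ v≰u ]′ (≤∞-total (νᵛ u) (νᵛ v))

    u+v-v≋u : (u +ᵛ v) +ᵛ -ᵛ v ≋ u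
    u+v-v≋u i = sym (KG.x≈z//y (u i) (v i) _ refl)

    bound : (νᵛ (u +ᵛ v) ⊓∞ νᵛ v) ≤∞ νᵛ u
    bound = subst₂ _≤∞_ (cong (νᵛ (u +ᵛ v) ⊓∞_) (νᵛ-‿ v)) (νᵛ-resp u+v-v≋u) (νᵛ-+ (u +ᵛ v) (-ᵛ v))

    upper : νᵛ (u +ᵛ v) ≤∞ (νᵛ u ⊓∞ νᵛ v)
    upper with ⊓∞-sel (νᵛ (u +ᵛ v)) (νᵛ v)
    ... | inj₁ min≡sum = subst₂ _≤∞_ min≡sum (sym (x≤y⇒x⊓∞y≡x u≤v)) bound
    ... | inj₂ min≡v   = ⊥-elim (v≰u (subst (_≤∞ νᵛ u) min≡v bound))

  InSphere⇒Integralᵛ : ∀ {m} {v : Vecᴷ m} → InSphere v → Integralᵛ v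
  InSphere⇒Integralᵛ {v = v} v∈𝕊 i = subst (_≤∞ ν (v i)) v∈𝕊 (νᵛ≤ν v i)

  InSphere⇒red≢0 : ∀ {m} {v : Vecᴷ m} → InSphere v → ∃ λ i → red (v i) ≢ 0F
  InSphere⇒red≢0 {v = v} v∈𝕊 with νᵛ-attained v
  ... | inj₁ νᵛv≡∞      = ⊥-elim (fin≢∞ (trans (sym v∈𝕊) νᵛv≡∞))
  ... | inj₂ (i , νᵛv≡) = i , unit⇒red≢0 (trans (sym νᵛv≡) v∈𝕊)

  InSphere⇒≢0 : ∀ {m} {v : Vecᴷ m} → InSphere v → ¬ v ≋ 0ᵛ
  InSphere⇒≢0 v∈𝕊 v≋0 = let i , redvi≢0 = InSphere⇒red≢0 v∈𝕊 in redvi≢0 (trans (cong red (v≋0 i)) red-0)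

  red≢0⇒InSphere : ∀ {m} {v : Vecᴷ m} → Integralᵛ v → ∀ i → red (v i) ≢ 0F → InSphere v
  red≢0⇒InSphere {v = v} iv i redvi≢0 =
    ≤∞-antisym (subst (νᵛ v ≤∞_) (red≢0⇒unit (iv i) redvi≢0) (νᵛ≤ν v i)) (νᵛ-glb v iv)

  InSphere-· : ∀ {m c} {v : Vecᴷ m} → ν c ≡ fin (+ 0) → InSphere v → InSphere (c · v)
  InSphere-· {c = c} {v} νc≡0 v∈𝕊 = trans (νᵛ-· c v) (cong₂ _+∞_ νc≡0 v∈𝕊)

  normalise : ∀ {m} {v : Vecᴷ m} → ¬ v ≋ 0ᵛ → ∃₂ λ δ p → δ * v p ≡ 1# × InSphere (δ · v)
  normalise {v = v} v≢0 with νᵛ-attained v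
  ... | inj₁ νᵛv≡∞ = ⊥-elim (v≢0 (νᵛ≡∞⇒≋0 νᵛv≡∞))
  ... | inj₂ (p , νᵛv≡νvp) with v p ≟0
  ...   | yes vp≡0 = ⊥-elim (v≢0 (νᵛ≡∞⇒≋0 (trans νᵛv≡νvp (trans (cong ν vp≡0) ν-0))))
  ...   | no vp≢0  =
          let β , vpβ≡1 = inverse (v p) vp≢0
              βvp≡1     = trans (*-comm β (v p)) vpβ≡1
          in β , p , βvp≡1 , (begin
            νᵛ (β · v)       ≡⟨ νᵛ-· β v ⟩
            ν β +∞ νᵛ v      ≡⟨ cong (ν β +∞_) νᵛv≡νvp ⟩
            ν β +∞ ν (v p)   ≡⟨ ν-inverse βvp≡1 ⟩
            fin (+ 0)        ∎)

  ScaleClosed : ∀ {n} → (Vecᴷ n → Set) → Set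
  ScaleClosed V = ∀ c {v} → V v → V (c · v)

  orthogonal⇒γ∉μ : ∀ {n} {V : Vecᴷ n → Set} {u} → InSphere u → OrthogonalSub (Line u) V → ¬ μ V (γ u)
  orthogonal⇒γ∉μ u∈𝕊 _ (inj₂ γu≋0) = let i , redui≢0 = InSphere⇒red≢0 u∈𝕊 in redui≢0 (γu≋0 i)
  orthogonal⇒γ∉μ {u = u} u∈𝕊 u⊥V (inj₁ (v , Vv , v∈𝕊 , γv≋γu)) =
    1≰0 (subst (fin (+ 1) ≤∞_) νᵛ[u-v]≡0 1≤νᵛ[u-v])
    where
    u-v : Vecᴷ _
    u-v = 1# · u +ᵛ (- 1#) · v

    νᵛ[u-v]≡0 : νᵛ u-v ≡ fin (+ 0)
    νᵛ[u-v]≡0 = trans (u⊥V u v (1# , λ i → sym (*-identityˡ (u i))) Vv 1# (- 1#))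
                      (cong₂ _⊓∞_ (InSphere-· {v = u} ν-1 u∈𝕊) (InSphere-· {v = v} ν-‿1 v∈𝕊))

    1≤νᵛ[u-v] : fin (+ 1) ≤∞ νᵛ u-v
    1≤νᵛ[u-v] = νᵛ-glb u-v λ i →
      subst (λ x → fin (+ 1) ≤∞ ν x) (sym (cong₂ _+_ (*-identityˡ (u i)) (-1*x≈-x (v i))))
            (red≡⇒1≤ν[x-y] (InSphere⇒Integralᵛ u∈𝕊 i) (InSphere⇒Integralᵛ v∈𝕊 i) (sym (γv≋γu i)))

  γ∉μ⇒u+y∈𝕊 : ∀ {n} {V : Vecᴷ n → Set} {u y} → ScaleClosed V → InSphere u → ¬ μ V (γ u) →
               V y → InSphere y → InSphere (u +ᵛ y)
  γ∉μ⇒u+y∈𝕊 {u = u} {y} closed u∈𝕊 γu∉μV Vy y∈𝕊 with Fin.all? (λ i → red (u i + y i) ≟F 0F)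
  ... | no γ[u+y]≢0 =
        let i , redi≢0 = Fin.¬∀⟶∃¬ _ _ (λ i → red (u i + y i) ≟F 0F) γ[u+y]≢0
        in red≢0⇒InSphere (λ j → Integral-+ (InSphere⇒Integralᵛ u∈𝕊 j) (InSphere⇒Integralᵛ y∈𝕊 j)) i redi≢0
  ... | yes γ[u+y]≋0 =
        ⊥-elim (γu∉μV (inj₁ ((- 1#) · y , closed (- 1#) Vy , InSphere-· {v = y} ν-‿1 y∈𝕊 , γ[-y]≋γu)))
    where
    iu = InSphere⇒Integralᵛ u∈𝕊
    iy = InSphere⇒Integralᵛ y∈𝕊
    γ[-y]≋γu : ∀ i → red (- 1# * y i) ≡ red (u i)
    γ[-y]≋γu i = begin
      red (- 1# * y i)  ≡⟨ cong red (-1*x≈-x (y i)) ⟩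
      red (- y i)       ≡⟨ red-‿ (iy i) ⟩
      -F red (y i)      ≡⟨ sym (FG.inverseˡ-unique (red (u i)) (red (y i))
                                 (trans (sym (red-+ (u i) (y i) (iu i) (iy i))) (γ[u+y]≋0 i))) ⟩
      red (u i)         ∎

  γ∉μ⇒νᵛ[u+y] : ∀ {n} {V : Vecᴷ n → Set} {u y} → ScaleClosed V → InSphere u → ¬ μ V (γ u) →
                V y → νᵛ (u +ᵛ y) ≡ νᵛ u ⊓∞ νᵛ y
  γ∉μ⇒νᵛ[u+y] {u = u} {y} closed u∈𝕊 γu∉μV Vy with νᵛ y ≤∞? νᵛ u | νᵛ u ≤∞? νᵛ y
  ... | no y≰u  | _       = νᵛ-+-dominant u y y≰u
  ... | yes _   | no u≰y  = trans (νᵛ-resp (λ i → +-comm (u i) (y i)))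
                                  (trans (νᵛ-+-dominant y u u≰y) (⊓∞-comm (νᵛ y) (νᵛ u)))
  ... | yes y≤u | yes u≤y =
        let y∈𝕊 = trans (≤∞-antisym y≤u u≤y) u∈𝕊
        in trans (γ∉μ⇒u+y∈𝕊 closed u∈𝕊 γu∉μV Vy y∈𝕊) (sym (cong₂ _⊓∞_ u∈𝕊 y∈𝕊))

  γ∉μ⇒orthogonal : ∀ {n} {V : Vecᴷ n → Set} {u} → ScaleClosed V → InSphere u → ¬ μ V (γ u) →
                   OrthogonalSub (Line u) V
  γ∉μ⇒orthogonal {V = V} {u} closed u∈𝕊 γu∉μV w v (c , w≋cu) Vv a b = begin
    νᵛ (a · w +ᵛ b · v)             ≡⟨ νᵛ-resp (λ i → cong (_+ b * v i) (aw≋acu i)) ⟩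
    νᵛ ((a * c) · u +ᵛ b · v)       ≡⟨ νᵛ[αu+y] (a * c) (closed b Vv) ⟩
    νᵛ ((a * c) · u) ⊓∞ νᵛ (b · v)  ≡⟨ cong (_⊓∞ νᵛ (b · v)) (νᵛ-resp (sym ∘ aw≋acu)) ⟩
    νᵛ (a · w) ⊓∞ νᵛ (b · v)        ∎
    where
    aw≋acu : a · w ≋ (a * c) · u
    aw≋acu i = trans (cong (a *_) (w≋cu i)) (sym (*-assoc a c (u i)))

    νᵛ[αu+y] : ∀ α {y} → V y → νᵛ (α · u +ᵛ y) ≡ νᵛ (α · u) ⊓∞ νᵛ y
    νᵛ[αu+y] α {y} Vy with α ≟0
    ... | yes α≡0 = trans (νᵛ-resp (λ i → trans (cong (λ a → a * u i + y i) α≡0) 0u+y≡y))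
                          (cong (_⊓∞ νᵛ y) (sym νᵛ[αu]≡∞))
      where
      0u+y≡y : ∀ {i} → 0# * u i + y i ≡ y i
      0u+y≡y {i} = trans (cong (_+ y i) (zeroˡ (u i))) (+-identityˡ (y i))
      νᵛ[αu]≡∞ : νᵛ (α · u) ≡ ∞
      νᵛ[αu]≡∞ = trans (νᵛ-· α u) (cong (_+∞ νᵛ u) (trans (cong ν α≡0) ν-0))
    ... | no α≢0 = let β , αβ≡1 = inverse α α≢0 in begin
      νᵛ (α · u +ᵛ y)                       ≡⟨ νᵛ-resp (factor β αβ≡1) ⟩
      νᵛ (α · (u +ᵛ β · y))                 ≡⟨ νᵛ-· α (u +ᵛ β · y) ⟩
      ν α +∞ νᵛ (u +ᵛ β · y)                ≡⟨ cong (ν α +∞_) (γ∉μ⇒νᵛ[u+y] closed u∈𝕊 γu∉μV (closed β Vy)) ⟩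
      ν α +∞ (νᵛ u ⊓∞ νᵛ (β · y))           ≡⟨ +∞-distribˡ-⊓∞ (ν α) _ _ ⟩
      (ν α +∞ νᵛ u) ⊓∞ (ν α +∞ νᵛ (β · y))  ≡⟨ sym (cong₂ _⊓∞_ (νᵛ-· α u) (νᵛ-· α (β · y))) ⟩
      νᵛ (α · u) ⊓∞ νᵛ (α · β · y)          ≡⟨ cong (νᵛ (α · u) ⊓∞_) (νᵛ-resp (cancel β αβ≡1)) ⟩
      νᵛ (α · u) ⊓∞ νᵛ y                    ∎
      where
      cancel : ∀ β → α * β ≡ 1# → α · β · y ≋ y
      cancel β αβ≡1 i = trans (sym (*-assoc α β (y i))) (trans (cong (_* y i) αβ≡1) (*-identityˡ (y i)))
      factor : ∀ β → α * β ≡ 1# → α · u +ᵛ y ≋ α · (u +ᵛ β · y)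
      factor β αβ≡1 i = sym (trans (distribˡ α (u i) (β * y i)) (cong (λ x → α * u i + x) (cancel β αβ≡1 i)))

  Line-rescale : ∀ {n} {V : Vecᴷ n → Set} {u} δ → OrthogonalSub (Line u) V → OrthogonalSub (Line (δ · u)) V
  Line-rescale {u = u} δ u⊥V w v (c , w≋cδu) =
    u⊥V w v (c * δ , λ i → trans (w≋cδu i) (sym (*-assoc c δ (u i))))

  orthogonal⇒μ⊈ : ∀ {n} {U V : Vecᴷ n → Set} {u} → ScaleClosed U → U u → ¬ u ≋ 0ᵛ →
                  OrthogonalSub (Line u) V → ¬ (∀ x → μ U x → μ V x)
  orthogonal⇒μ⊈ {u = u} closed Uu u≢0 u⊥V μU⊆μV =
    let δ , _ , _ , δu∈𝕊 = normalise u≢0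
    in orthogonal⇒γ∉μ δu∈𝕊 (Line-rescale δ u⊥V) (μU⊆μV _ (inj₁ (δ · u , closed δ Uu , δu∈𝕊 , λ _ → refl)))

  feeblyOrthogonal⇒μ≢ : ∀ {n} {U V : Vecᴷ n → Set} → ScaleClosed U → ScaleClosed V →
                        FeeblyOrthogonal U V → ¬ SameSet (μ U) (μ V)
  feeblyOrthogonal⇒μ≢ closedU _ (inj₁ (u , Uu , u≢0 , u⊥V)) μU≡μV =
    orthogonal⇒μ⊈ closedU Uu u≢0 u⊥V (proj₁ ∘ μU≡μV)
  feeblyOrthogonal⇒μ≢ _ closedV (inj₂ (v , Vv , v≢0 , v⊥U)) μU≡μV =
    orthogonal⇒μ⊈ closedV Vv v≢0 v⊥U (proj₂ ∘ μU≡μV)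

  module _ {n : ℕ} where

    Pivoted : Set
    Pivoted = Fin n × Vecᴷ n

    vectors : List Pivoted → List (Vecᴷ n)
    vectors = map proj₂

    residues : List Pivoted → List (Fin n → F)
    residues R = map γ (vectors R)

    _vanishesAtPivotOf_ : Vecᴷ n → Pivoted → Set
    v vanishesAtPivotOf (q , _) = v q ≡ 0#

    IntegralAtPivots : Vecᴷ n → List Pivoted → Set
    IntegralAtPivots w R = All (λ (q , _) → Integral (w q)) R

    data Echelon : List Pivoted → Set where
      []    : Echelon []
      pivot : ∀ {p u R} → InSphere u → u p ≡ 1# → All (u vanishesAtPivotOf_) R → Echelon R →
              Echelon ((p , u) ∷ R)

    Echelon⇒InSphere : ∀ {R} → Echelon R → All InSphere (vectors R)
    Echelon⇒InSphere []                  = []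
    Echelon⇒InSphere (pivot u∈𝕊 _ _ E) = u∈𝕊 ∷ Echelon⇒InSphere E

    reduce : ∀ {R} → Echelon R → ∀ b →
             ∃₂ λ b* r → All (b* vanishesAtPivotOf_) R × 𝕂.Span (vectors R) r × b* ≋ b +ᵛ r
    reduce [] b = b , 0ᵛ , [] , (λ _ → refl) , λ i → sym (+-identityʳ (b i))
    reduce (pivot {p} {u} _ up≡1 u⊥R E) b with reduce E b
    ... | b₁ , r₁ , b₁⊥R , r₁∈ , b₁≋ =
          c · u +ᵛ b₁ , c · u +ᵛ r₁ ,
          b*p≡0 ∷ All.zipWith (λ (uq≡0 , b₁q≡0) → b*q≡0 uq≡0 b₁q≡0) (u⊥R , b₁⊥R) ,
          (c , r₁ , r₁∈ , λ _ → refl) , b*≋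
      where
      c = - b₁ p

      b*p≡0 : c * u p + b₁ p ≡ 0#
      b*p≡0 = trans (cong (λ t → c * t + b₁ p) up≡1)
                    (trans (cong (_+ b₁ p) (*-identityʳ c)) (-‿inverseˡ (b₁ p)))

      b*q≡0 : ∀ {q} → u q ≡ 0# → b₁ q ≡ 0# → c * u q + b₁ q ≡ 0#
      b*q≡0 uq≡0 b₁q≡0 =
        trans (cong₂ (λ s t → c * s + t) uq≡0 b₁q≡0) (trans (cong (_+ 0#) (zeroʳ c)) (+-identityʳ 0#))

      b*≋ : c · u +ᵛ b₁ ≋ b +ᵛ (c · u +ᵛ r₁)
      b*≋ i = trans (cong (λ x → c * u i + x) (b₁≋ i)) (x∙yz≈y∙xz (c * u i) (b i) (r₁ i))

    adjoin : ∀ {R b*} {X : Vecᴷ n → Set} → Echelon R → All (b* vanishesAtPivotOf_) R →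
             X ≐ 𝕂.Span (b* ∷ vectors R) → ∃ λ R′ → Echelon R′ × X ≐ 𝕂.Span (vectors R′)
    adjoin {R} {b*} E b*⊥R X≐ with Fin.all? (λ i → b* i ≟0)
    ... | yes b*≋0 = R , E , ≐-trans X≐ (𝕂.Span-∷-0 b*≋0)
    ... | no b*≢0 with normalise b*≢0
    ...   | δ , p , δb*p≡1 , δb*∈𝕊 =
            (p , δ · b*) ∷ R ,
            pivot δb*∈𝕊 δb*p≡1 (All.map (λ b*q≡0 → trans (cong (δ *_) b*q≡0) (zeroʳ δ)) b*⊥R) E ,
            ≐-trans X≐ (𝕂.Span-∷-scale (trans (*-comm (b* p) δ) δb*p≡1))

    echelonise : ∀ L → ∃ λ R → Echelon R × 𝕂.Span L ≐ 𝕂.Span (vectors R)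
    echelonise []      = [] , [] , id , id
    echelonise (b ∷ L) =
      let R , E , L≐R               = echelonise L
          b* , r , b*⊥R , r∈R , b*≋ = reduce E b
      in adjoin E b*⊥R (≐-trans (𝕂.Span-∷-cong L≐R) (𝕂.Span-∷-shear r∈R b*≋))

    -- The head vanishes at the later pivots, so there the rest of the combination agrees with w;
    -- by induction it is integral, and then so is the head coefficient, w p − w′ p.
    integralAtPivots⇒residueSpan : ∀ {R w} → Echelon R → 𝕂.Span (vectors R) w → IntegralAtPivots w R →
                                   Integralᵛ w × 𝔽.Span (residues R) (γ w)
    integralAtPivots⇒residueSpan [] w≋0 [] =
      (λ i → subst Integral (sym (w≋0 i)) Integral-0) , λ i → trans (cong red (w≋0 i)) red-0
    integralAtPivots⇒residueSpan {w = w} (pivot {p} {u} u∈𝕊 up≡1 u⊥R E) (c , w′ , w′∈ , w≋) (iwp ∷ iwR) =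
      iw , red c , γ w′ , proj₂ IH , γw≋
      where
      iu = InSphere⇒Integralᵛ u∈𝕊

      w′q≡wq : ∀ {q} → u q ≡ 0# → w′ q ≡ w q
      w′q≡wq {q} uq≡0 = sym (begin
        w q             ≡⟨ w≋ q ⟩
        c * u q + w′ q  ≡⟨ cong (λ t → c * t + w′ q) uq≡0 ⟩
        c * 0# + w′ q   ≡⟨ cong (_+ w′ q) (zeroʳ c) ⟩
        0# + w′ q       ≡⟨ +-identityˡ (w′ q) ⟩
        w′ q            ∎)

      IH = integralAtPivots⇒residueSpan E w′∈
             (All.zipWith (λ (uq≡0 , iwq) → subst Integral (sym (w′q≡wq uq≡0)) iwq) (u⊥R , iwR))
      iw′ = proj₁ IH

      c+w′p≡wp : c + w′ p ≡ w p
      c+w′p≡wp = sym (trans (w≋ p) (trans (cong (λ t → c * t + w′ p) up≡1) (cong (_+ w′ p) (*-identityʳ c))))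

      ic : Integral c
      ic = subst Integral (sym (KG.x≈z//y c (w′ p) (w p) c+w′p≡wp)) (Integral-+ iwp (Integral-‿ (iw′ p)))

      iw : Integralᵛ w
      iw i = subst Integral (sym (w≋ i)) (Integral-+ (Integral-* ic (iu i)) (iw′ i))

      γw≋ : γ w 𝔽.≋ red c 𝔽.· γ u 𝔽.+ᵛ γ w′
      γw≋ i = begin
        red (w i)                           ≡⟨ cong red (w≋ i) ⟩
        red (c * u i + w′ i)                ≡⟨ red-+ _ _ (Integral-* ic (iu i)) (iw′ i) ⟩
        red (c * u i) +F red (w′ i)         ≡⟨ cong (_+F red (w′ i)) (red-* c (u i) ic (iu i)) ⟩
        (red c *F red (u i)) +F red (w′ i)  ∎

    residueSpan-lift : ∀ {us x} → All Integralᵛ us → 𝔽.Span (map γ us) x →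
                       ∃ λ (w : Vecᴷ n) → 𝕂.Span us w × Integralᵛ w × γ w 𝔽.≋ x
    residueSpan-lift [] x≋0 = 0ᵛ , (λ _ → refl) , (λ _ → Integral-0) , λ i → trans red-0 (sym (x≋0 i))
    residueSpan-lift {u ∷ us} {x} (iu ∷ ius) (f , x′ , x′∈ , x≋) with residueSpan-lift ius x′∈ | red-surj f
    ... | w′ , w′∈ , iw′ , γw′≋x′ | c , ic , redc≡f =
      c · u +ᵛ w′ , (c , w′ , w′∈ , λ _ → refl) , (λ i → Integral-+ (icu i) (iw′ i)) , λ i → begin
        red (c * u i + w′ i)         ≡⟨ red-+ _ _ (icu i) (iw′ i) ⟩
        red (c * u i) +F red (w′ i)  ≡⟨ cong₂ _+F_ (trans (red-* c (u i) ic (iu i)) (cong (_*F red (u i)) redc≡f))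
                                                   (γw′≋x′ i) ⟩
        (f *F red (u i)) +F x′ i     ≡⟨ sym (x≋ i) ⟩
        x i                          ∎
      where
      icu : Integralᵛ (c · u)
      icu i = Integral-* ic (iu i)

    record EchelonBasis (V : Vecᴷ n → Set) : Set where
      field
        pivots  : List Pivoted
        echelon : Echelon pivots
        spans   : V ≐ 𝕂.Span (vectors pivots)

    open EchelonBasis

    Span≐ : ∀ {s} (b : Fin s → Vecᴷ n) → Span b ≐ 𝕂.Span (tabulate b)
    Span≐ {zero}  b = (λ (_ , v≋0) → v≋0) , λ v≋0 → (λ ()) , v≋0
    Span≐ {suc s} b =
        (λ (c , v≋) →
           c zero , lincomb (c ∘ suc) (b ∘ suc) , proj₁ (Span≐ (b ∘ suc)) (c ∘ suc , λ _ → refl) , v≋)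
      , (λ (c₀ , w′ , w′∈ , v≋) →
           let c′ , w′≋ = proj₂ (Span≐ (b ∘ suc)) w′∈
           in c₀ Vector.∷ c′ , λ i → trans (v≋ i) (cong (λ x → c₀ * b zero i + x) (w′≋ i)))

    Span-scaleClosed : ∀ {s} (b : Fin s → Vecᴷ n) → ScaleClosed (Span b)
    Span-scaleClosed b c v∈ = proj₂ (Span≐ b) (𝕂.Span-· _ c (proj₁ (Span≐ b) v∈))

    echelonBasis : ∀ {s} (b : Fin s → Vecᴷ n) → EchelonBasis (Span b)
    echelonBasis b =
      let R , E , L≐R = echelonise (tabulate b)
      in record { pivots = R ; echelon = E ; spans = ≐-trans (Span≐ b) L≐R }

    μ≐ : ∀ {V} (B : EchelonBasis V) → μ V ≐ 𝔽.Span (residues (pivots B))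
    μ≐ {V} B = μ⊆ , ⊆μ
      where
      μ⊆ : μ V ⊆ 𝔽.Span (residues (pivots B))
      μ⊆ (inj₂ x≋0) = 𝔽.Span-resp _ (λ i → sym (x≋0 i)) (𝔽.Span-0 _)
      μ⊆ (inj₁ (v , Vv , v∈𝕊 , γv≋x)) =
        𝔽.Span-resp _ γv≋x (proj₂ (integralAtPivots⇒residueSpan (echelon B) (proj₁ (spans B) Vv)
                                     (All.tabulate λ {e} _ → InSphere⇒Integralᵛ v∈𝕊 (proj₁ e))))

      ⊆μ : 𝔽.Span (residues (pivots B)) ⊆ μ V
      ⊆μ {x} x∈ with Fin.all? (λ i → x i ≟F 0F)
      ... | yes x≋0 = inj₂ x≋0
      ... | no x≢0 with Fin.¬∀⟶∃¬ n _ (λ i → x i ≟F 0F) x≢0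
                      | residueSpan-lift (All.map (InSphere⇒Integralᵛ {n}) (Echelon⇒InSphere (echelon B))) x∈
      ...   | i , xi≢0 | w , w∈ , iw , γw≋x =
              inj₁ (w , proj₂ (spans B) w∈ , red≢0⇒InSphere iw i (xi≢0 ∘ trans (sym (γw≋x i))) , γw≋x)

    residue? : ∀ R → Decidable (𝔽.Span (residues R))
    residue? R = 𝔽.Span? _≟F_ ∃F? (residues R)

    ResiduesIn : List Pivoted → List Pivoted → Set
    ResiduesIn R S = All (λ u → 𝔽.Span (residues S) (γ u)) (vectors R)

    residuesIn⇒μ⊆ : ∀ {U V} (BU : EchelonBasis U) (BV : EchelonBasis V) →
                       ResiduesIn (pivots BU) (pivots BV) → μ U ⊆ μ V
    residuesIn⇒μ⊆ BU BV γU⊆ x∈μU = proj₂ (μ≐ BV) (𝔽.Span-⊆ (map⁺ γU⊆) (proj₁ (μ≐ BU) x∈μU))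

    ¬residuesIn⇒orthogonal : ∀ {U V} (BU : EchelonBasis U) (BV : EchelonBasis V) → ScaleClosed V →
      ¬ ResiduesIn (pivots BU) (pivots BV) → ∃ λ u → U u × ¬ u ≋ 0ᵛ × OrthogonalSub (Line u) V
    ¬residuesIn⇒orthogonal BU BV closedV γU⊈ =
      let u , u∈ , γu∉ = find (¬All⇒Any¬ (residue? (pivots BV) ∘ γ) _ γU⊈)
          u∈𝕊          = All.lookup (Echelon⇒InSphere (echelon BU)) u∈
      in u , proj₂ (spans BU) (𝕂.∈⇒∈Span u∈) , InSphere⇒≢0 u∈𝕊 ,
         γ∉μ⇒orthogonal closedV u∈𝕊 (γu∉ ∘ proj₁ (μ≐ BV))

    μ≢⇒feeblyOrthogonal : ∀ {U V} → EchelonBasis U → EchelonBasis V → ScaleClosed U → ScaleClosed V →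
                          ¬ SameSet (μ U) (μ V) → FeeblyOrthogonal U V
    μ≢⇒feeblyOrthogonal BU BV closedU closedV μU≢μV
      with All.all? (residue? (pivots BV) ∘ γ) (vectors (pivots BU))
         | All.all? (residue? (pivots BU) ∘ γ) (vectors (pivots BV))
    ... | no γU⊈    | _         = inj₁ (¬residuesIn⇒orthogonal BU BV closedV γU⊈)
    ... | yes _     | no γV⊈    = inj₂ (¬residuesIn⇒orthogonal BV BU closedU γV⊈)
    ... | yes γU⊆   | yes γV⊆   = ⊥-elim (μU≢μV λ _ → residuesIn⇒μ⊆ BU BV γU⊆ , residuesIn⇒μ⊆ BV BU γV⊆)

lemma3p6 : (D : DVField) → let open Theory D in
    (s n : ℕ) → 1 ≤ s → s ≤ n →
    (bU bV : Fin s → Vecᴷ n) → LinIndep bU → LinIndep bV →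
    (FeeblyOrthogonal (Span bU) (Span bV) → ¬ SameSet (μ (Span bU)) (μ (Span bV)))
    × (¬ SameSet (μ (Span bU)) (μ (Span bV)) → FeeblyOrthogonal (Span bU) (Span bV))
lemma3p6 D s n _ _ bU bV _ _ =
    feeblyOrthogonal⇒μ≢ (Span-scaleClosed bU) (Span-scaleClosed bV)
  , μ≢⇒feeblyOrthogonal (echelonBasis bU) (echelonBasis bV) (Span-scaleClosed bU) (Span-scaleClosed bV)
  where open ValuedField D
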